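{- Let $M$ be a matrix, let $\sigma$ be a substitution, and let $\Gamma$ be a spanning set of connections for $(M,\sigma)$. Suppose that $M$ is minimal, i.e. there is no strict subset $M' \subsetneq M$ for which there exist a substitution $\sigma'$ and a spanning set of connections for $(M',\sigma')$. Then $M$ is fully connected with respect to $\Gamma$: every literal occurrence $(C,L)$ with $C\in M$, $L\in C$ lies in some connection $\{(C,L),(D,K)\}\in\Gamma$ (necessarily with $D\neq C$).
   Context: Work in classical first-order logic. A clause is a finite set of literals (read as their disjunction). A matrix is a finite set of clauses whose variables are pairwise disjoint (each clause is a variable-renamed copy of an input clause, and the clauses are renamed apart). A single global substitution $\sigma$ is applied to the whole matrix. A literal occurrence of $M$ is a pair $(C,L)$ with $C\in M$ and $L\in C$. Two literals are connected (modulo $\sigma$) if $\sigma(L)$ and $\sigma(K)$ have the same atom and opposite polarity. A connection for $(M,\sigma)$ is an unordered pair $\{(C,L),(D,K)\}$ of literal occurrences with $C\neq D$ such that $\sigma(L)$ and $\sigma(K)$ are complementary; a set of connections for $(M,\sigma)$ is a set $\Gamma$ of such pairs. A path through $M$ is a set of literal occurrences containing exactly one occurrence from each clause of $M$. A path is open with respect to $\Gamma$ if it contains no pair belonging to $\Gamma$, and closed otherwise. $\Gamma$ is spanning if no path through $M$ is open with respect to $\Gamma$. -}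

module Defs where

open import Data.Nat using (ℕ)
open import Data.Bool using (Bool; not)
open import Data.List using (List; []; _∷_)
open import Data.List.Membership.Propositional using (_∈_; _∉_)
open import Data.Product using (_×_; _,_; Σ; ∃; ∃-syntax)
open import Data.Sum using (_⊎_)
open import Relation.Binary.PropositionalEquality using (_≡_)
open import Relation.Nullary using (¬_)
open import Function.Bundles using (_⇔_)

-- First-order syntax.  Variables, function symbols and predicate
-- symbols are natural numbers; the arity of an application is the
-- length of its argument list.

data Term : Set where
  var : ℕ → Term
  fun : ℕ → List Term → Term

record Atom : Set where
  constructor pred
  field
    sym  : ℕ
    args : List Term

-- polarity true = positive literal, false = negated literal
record Literal : Set where
  constructor lit
  field
    pol  : Bool
    atom : Atom
open Literal public

Substitution : Set
Substitution = ℕ → Term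

mutual
  substT : Substitution → Term → Term
  substT σ (var x)    = σ x
  substT σ (fun f ts) = fun f (substTs σ ts)

  substTs : Substitution → List Term → List Term
  substTs σ []       = []
  substTs σ (t ∷ ts) = substT σ t ∷ substTs σ ts

substA : Substitution → Atom → Atom
substA σ (pred p ts) = pred p (substTs σ ts)

substL : Substitution → Literal → Literal
substL σ (lit b a) = lit b (substA σ a)

mutual
  data _occursInT_ (x : ℕ) : Term → Set where
    here : x occursInT var x
    arg  : ∀ {f ts} → x occursInTs ts → x occursInT fun f ts

  data _occursInTs_ (x : ℕ) : List Term → Set where
    hd : ∀ {t ts} → x occursInT t → x occursInTs (t ∷ ts)
    tl : ∀ {t ts} → x occursInTs ts → x occursInTs (t ∷ ts)

_occursInL_ : ℕ → Literal → Set
x occursInL L = x occursInTs Atom.args (atom L)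

-- Clause: finite set of literals, represented by a list (membership
-- is all that matters).
Clause : Set
Clause = List Literal

_occursInC_ : ℕ → Clause → Set
x occursInC C = ∃[ L ] (L ∈ C × x occursInL L)

-- Matrix: finite set of clauses (a list), whose clauses are pairwise
-- distinct as sets and pairwise variable-disjoint.
Matrix : Set
Matrix = List Clause

IsMatrix : Matrix → Set
IsMatrix M =
  (∀ C D → C ∈ M → D ∈ M → (∀ L → (L ∈ C ⇔ L ∈ D)) → C ≡ D) ×
  (∀ C D → C ∈ M → D ∈ M → ¬ (C ≡ D) → ∀ x → x occursInC C → ¬ (x occursInC D))

Occ : Set
Occ = Clause × Literal

IsOccOf : Matrix → Occ → Set
IsOccOf M (C , L) = C ∈ M × L ∈ C

Complementary : Literal → Literal → Set
Complementary L K = atom L ≡ atom K × pol L ≡ not (pol K)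

-- A connection for (M , σ): unordered pair of occurrences, represented
-- as an ordered pair (either orientation counts as the same pair).
IsConnection : Matrix → Substitution → Occ × Occ → Set
IsConnection M σ ((C , L) , (D , K)) =
  IsOccOf M (C , L) × IsOccOf M (D , K) × ¬ (C ≡ D) ×
  Complementary (substL σ L) (substL σ K)

ConnectionSet : Set
ConnectionSet = List (Occ × Occ)

IsConnectionSet : Matrix → Substitution → ConnectionSet → Set
IsConnectionSet M σ Γ = ∀ c → c ∈ Γ → IsConnection M σ c

InΓ : Occ → Occ → ConnectionSet → Set
InΓ o o' Γ = ((o , o') ∈ Γ) ⊎ ((o' , o) ∈ Γ)

IsPath : Matrix → (Occ → Set) → Set
IsPath M P =
  (∀ o → P o → IsOccOf M o) ×
  (∀ C → C ∈ M → ∃[ L ] P (C , L)) ×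
  (∀ C L K → P (C , L) → P (C , K) → L ≡ K)

Open : ConnectionSet → (Occ → Set) → Set
Open Γ P = ∀ o o' → InΓ o o' Γ → ¬ (P o × P o')

Spanning : Matrix → ConnectionSet → Set₁
Spanning M Γ = ∀ (P : Occ → Set) → IsPath M P → ¬ Open Γ P

_⊊_ : Matrix → Matrix → Set
M' ⊊ M = (∀ C → C ∈ M' → C ∈ M) × (∃[ C ] (C ∈ M × C ∉ M'))

Minimal : Matrix → Set₁
Minimal M = ¬ (Σ Matrix λ M' → M' ⊊ M × Σ Substitution λ σ' →
                 Σ ConnectionSet λ Γ' → IsConnectionSet M' σ' Γ' × Spanning M' Γ')

FullyConnected : Matrix → ConnectionSet → Set
FullyConnected M Γ = ∀ C L → C ∈ M → L ∈ C → ∃[ D ] ∃[ K ] InΓ (C , L) (D , K) Γ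

{-# OPTIONS --safe #-}
module Submission where

-- If the occurrence (C , L) lies in no connection of Γ, delete the clause C
-- from M and every connection touching C from Γ.  Any path through the smaller
-- matrix extends by (C , L) to a path through M, and a connection of Γ on the
-- extended path cannot touch (C , L), so it survives the deletion; hence the
-- smaller connection set is still spanning, contradicting minimality.

open import Defs
open import Data.Bool.Properties using () renaming (_≟_ to _≟ᵇ_)
open import Data.List using (List; []; _∷_; filter)
open import Data.List.Properties using (∷-dec; ≡-dec)
open import Data.List.Relation.Unary.Any using (Any; any?)
open import Data.List.Membership.Propositional using (_∈_; find; lose)
open import Data.List.Membership.Propositional.Properties using (∈-filter⁺; ∈-filter⁻)
open import Data.Nat.Properties using () renaming (_≟_ to _≟ⁿ_)
open import Data.Product using (_×_; _,_; ∃-syntax; proj₁; proj₂)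
import Data.Product.Properties as ×
open import Data.Sum using (_⊎_; inj₁; inj₂)
open import Relation.Binary.Definitions using (DecidableEquality)
open import Relation.Binary.PropositionalEquality using (_≡_; _≢_; refl; cong₂)
open import Relation.Nullary using (¬_; ¬?; Dec; yes; no)
open import Relation.Nullary.Decidable using (map′; _×-dec_; _⊎-dec_)

mutual
  _≟ᵗ_ : DecidableEquality Term
  var x ≟ᵗ var y = map′ (λ { refl → refl }) (λ { refl → refl }) (x ≟ⁿ y)
  var _ ≟ᵗ fun _ _ = no λ ()
  fun _ _ ≟ᵗ var _ = no λ ()
  fun f ts ≟ᵗ fun g us =
    map′ (λ { (refl , refl) → refl }) (λ { refl → refl , refl }) (f ≟ⁿ g ×-dec ts ≟ᵗˢ us)

  _≟ᵗˢ_ : DecidableEquality (List Term)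
  [] ≟ᵗˢ [] = yes refl
  [] ≟ᵗˢ (_ ∷ _) = no λ ()
  (_ ∷ _) ≟ᵗˢ [] = no λ ()
  (t ∷ ts) ≟ᵗˢ (u ∷ us) = ∷-dec (t ≟ᵗ u) (ts ≟ᵗˢ us)

_≟ᵃ_ : DecidableEquality Atom
pred p ts ≟ᵃ pred q us =
  map′ (λ (p≡q , ts≡us) → cong₂ pred p≡q ts≡us) (λ { refl → refl , refl }) (p ≟ⁿ q ×-dec ts ≟ᵗˢ us)

_≟ˡ_ : DecidableEquality Literal
lit b a ≟ˡ lit c e =
  map′ (λ (b≡c , a≡e) → cong₂ lit b≡c a≡e) (λ { refl → refl , refl }) (b ≟ᵇ c ×-dec a ≟ᵃ e)

_≟ᶜ_ : DecidableEquality Clause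
_≟ᶜ_ = ≡-dec _≟ˡ_

_≟ᵒ_ : DecidableEquality Occ
_≟ᵒ_ = ×.≡-dec _≟ᶜ_ _≟ˡ_

Touches : Occ → Occ × Occ → Set
Touches o (o₁ , o₂) = o₁ ≡ o ⊎ o₂ ≡ o

touches? : ∀ o c → Dec (Touches o c)
touches? o (o₁ , o₂) = o₁ ≟ᵒ o ⊎-dec o₂ ≟ᵒ o

touching⇒InΓ : ∀ {o Γ} → Any (Touches o) Γ → ∃[ D ] ∃[ K ] InΓ o (D , K) Γ
touching⇒InΓ touching with find touching
... | (_ , (D , K)) , c∈Γ , inj₁ refl = D , K , inj₁ c∈Γ
... | ((D , K) , _) , c∈Γ , inj₂ refl = D , K , inj₂ c∈Γ

distinctFrom? : (C D : Clause) → Dec (D ≢ C)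
distinctFrom? C D = ¬? (D ≟ᶜ C)

removeClause : Clause → Matrix → Matrix
removeClause C = filter (distinctFrom? C)

removeClause-⊊ : ∀ {C M} → C ∈ M → removeClause C M ⊊ M
removeClause-⊊ {C} {M} C∈M =
  (λ D D∈M′ → proj₁ (∈-filter⁻ (distinctFrom? C) {xs = M} D∈M′))
  , C , C∈M , λ C∈M′ → proj₂ (∈-filter⁻ (distinctFrom? C) {xs = M} C∈M′) refl

Avoids : Clause → Occ × Occ → Set
Avoids C ((D , _) , (E , _)) = D ≢ C × E ≢ C

avoids? : ∀ C c → Dec (Avoids C c)
avoids? C ((D , _) , (E , _)) = distinctFrom? C D ×-dec distinctFrom? C E

connectionsAvoiding : Clause → ConnectionSet → ConnectionSet
connectionsAvoiding C = filter (avoids? C)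

connectionsAvoiding-isConnectionSet : ∀ {M σ Γ} C → IsConnectionSet M σ Γ →
  IsConnectionSet (removeClause C M) σ (connectionsAvoiding C Γ)
connectionsAvoiding-isConnectionSet {Γ = Γ} C conn ((D , _) , (E , _)) c∈Γ′
  with ∈-filter⁻ (avoids? C) {xs = Γ} c∈Γ′
... | c∈Γ , D≢C , E≢C with conn _ c∈Γ
...   | (D∈M , L∈D) , (E∈M , K∈E) , D≢E , complementary =
    (∈-filter⁺ (distinctFrom? C) D∈M D≢C , L∈D)
  , (∈-filter⁺ (distinctFrom? C) E∈M E≢C , K∈E)
  , D≢E , complementary

insert : Occ → (Occ → Set) → (Occ → Set)
insert o P o′ = P o′ ⊎ o′ ≡ o

module _ {M : Matrix} {C : Clause} {P : Occ → Set} (path : IsPath (removeClause C M) P) where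

  path-avoids : ∀ {D K} → P (D , K) → D ≢ C
  path-avoids p = proj₂ (∈-filter⁻ (distinctFrom? C) {xs = M} (proj₁ (proj₁ path _ p)))

  insert-isPath : ∀ {L} → C ∈ M → L ∈ C → IsPath M (insert (C , L) P)
  insert-isPath {L} C∈M L∈C = occurrence , meets , unique
    where
      occurrence : ∀ o → insert (C , L) P o → IsOccOf M o
      occurrence o (inj₁ p) with proj₁ path o p
      ... | D∈M′ , K∈D = proj₁ (∈-filter⁻ (distinctFrom? C) {xs = M} D∈M′) , K∈D
      occurrence o (inj₂ refl) = C∈M , L∈C

      meets : ∀ D → D ∈ M → ∃[ K ] insert (C , L) P (D , K)
      meets D D∈M with D ≟ᶜ C
      ... | yes refl = L , inj₂ refl
      ... | no D≢C with proj₁ (proj₂ path) D (∈-filter⁺ (distinctFrom? C) D∈M D≢C)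
      ...   | K , p = K , inj₁ p

      unique : ∀ D K K′ → insert (C , L) P (D , K) → insert (C , L) P (D , K′) → K ≡ K′
      unique D K K′ (inj₁ p) (inj₁ p′) = proj₂ (proj₂ path) D K K′ p p′
      unique D K K′ (inj₁ p) (inj₂ refl) with () ← path-avoids p refl
      unique D K K′ (inj₂ refl) (inj₁ p′) with () ← path-avoids p′ refl
      unique D K K′ (inj₂ refl) (inj₂ refl) = refl

  insert-open : ∀ {Γ L} → ¬ Any (Touches (C , L)) Γ →
    Open (connectionsAvoiding C Γ) P → Open Γ (insert (C , L) P)
  insert-open {Γ} {L} isolated open′ o o′ (inj₁ c∈Γ) (p , p′) = closed c∈Γ (p , p′)
    where
      closed : ∀ {o o′} → (o , o′) ∈ Γ → ¬ (insert (C , L) P o × insert (C , L) P o′)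
      closed c∈Γ (inj₂ o≡CL , _) = isolated (lose c∈Γ (inj₁ o≡CL))
      closed c∈Γ (_ , inj₂ o′≡CL) = isolated (lose c∈Γ (inj₂ o′≡CL))
      closed c∈Γ (inj₁ p , inj₁ p′) =
        open′ _ _ (inj₁ (∈-filter⁺ (avoids? C) c∈Γ (path-avoids p , path-avoids p′))) (p , p′)
  insert-open isolated open′ o o′ (inj₂ c∈Γ) (p , p′) =
    insert-open isolated open′ o′ o (inj₁ c∈Γ) (p′ , p)

spanning-removeClause : ∀ {M Γ C L} → C ∈ M → L ∈ C → ¬ Any (Touches (C , L)) Γ →
  Spanning M Γ → Spanning (removeClause C M) (connectionsAvoiding C Γ)
spanning-removeClause {M} C∈M L∈C isolated spanning P path open′ =
  spanning _ (insert-isPath {M} path C∈M L∈C) (insert-open {M} path isolated open′)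

theorem1 : (M : Matrix) (σ : Substitution) (Γ : ConnectionSet) →
    IsMatrix M → IsConnectionSet M σ Γ → Spanning M Γ → Minimal M →
    FullyConnected M Γ
theorem1 M σ Γ _ conn spanning minimal C L C∈M L∈C with any? (touches? (C , L)) Γ
... | yes touching = touching⇒InΓ touching
... | no isolated with () ← minimal
  ( removeClause C M , removeClause-⊊ C∈M , σ , connectionsAvoiding C Γ
  , connectionsAvoiding-isConnectionSet C conn
  , spanning-removeClause C∈M L∈C isolated spanning )
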